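{- Let $n\geq 1$ and let $G$ be a connected graph on $n$ vertices. Then $$\binom{n+1}{2}\leq F(G)\leq M,\qquad M=\sum_{i=1}^{n}\binom{n}{i}h_i .$$ In particular, among all connected graphs on $n$ vertices the core index is maximized by the complete graph $K_n$ (with $F(K_n)=M$) and minimized by the path $P_n$ (with $F(P_n)=\binom{n+1}{2}$).
   Context: All graphs are finite, simple and undirected. A connected subgraph of a graph $G=(V,E)$ is a graph $(V',E')$ with $\emptyset\neq V'\subseteq V$, $E'\subseteq E$, every edge of $E'$ having both endpoints in $V'$, and $(V',E')$ connected. Distinct pairs $(V',E')$ are counted as distinct subgraphs. The core index $F(G)$ is the number of connected subgraphs of $G$. Here $h_i$ denotes the number of connected labeled graphs on $i$ labeled vertices (so $h_1=1,h_2=1,h_3=4,\dots$). -}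

module Defs where

open import Data.Nat using (ℕ; zero; suc; _+_; _*_; _≡ᵇ_)
open import Data.Nat.Combinatorics using (_C_)
open import Data.Bool using (Bool; true; false; not; _∨_)
open import Data.Bool.Properties using (∨-comm)
open import Data.Fin using (Fin; toℕ; _≟_)
open import Data.Vec using (Vec; lookup)
open import Data.List using (List; length)
open import Data.List.Membership.Propositional using (_∈_)
open import Data.List.Relation.Unary.Unique.Propositional using (Unique)
open import Data.Product using (Σ; ∃; _×_; _,_)
open import Function.Bundles using (_⇔_)
open import Relation.Nullary.Decidable using (⌊_⌋)
open import Relation.Binary.PropositionalEquality using (_≡_; refl; sym; cong)
open import Relation.Nullary using (yes; no)
open import Data.Empty using (⊥-elim)

HasCount : {A : Set} → (A → Set) → ℕ → Set
HasCount {A} P k =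
  Σ (List A) λ xs → (length xs ≡ k) × Unique xs × ((x : A) → (x ∈ xs) ⇔ P x)

data Walk {n : ℕ} (R : Fin n → Fin n → Set) : Fin n → Fin n → Set where
  here : ∀ {i} → Walk R i i
  step : ∀ {i j k} → R i j → Walk R j k → Walk R i k

record Graph (n : ℕ) : Set where
  field
    adj    : Fin n → Fin n → Bool
    adj-sym : ∀ i j → adj i j ≡ adj j i
    irrefl : ∀ i → adj i i ≡ false

Adj : {n : ℕ} → Graph n → Fin n → Fin n → Set
Adj G i j = Graph.adj G i j ≡ true

Connected : {n : ℕ} → Graph n → Set
Connected {n} G = (i j : Fin n) → Walk (Adj G) i j

-- Subgraph data (V', E'): V' as a characteristic vector, E' as a
-- (symmetric) adjacency matrix.  This representation is canonical,
-- so distinct pairs (V', E') correspond to distinct data.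

SubData : ℕ → Set
SubData n = Vec Bool n × Vec (Vec Bool n) n

InV : {n : ℕ} → SubData n → Fin n → Set
InV (vs , es) i = lookup vs i ≡ true

InE : {n : ℕ} → SubData n → Fin n → Fin n → Set
InE (vs , es) i j = lookup (lookup es i) j ≡ true

IsConnSub : {n : ℕ} → Graph n → SubData n → Set
IsConnSub {n} G s =
  ((i j : Fin n) → InE s i j → Adj G i j × InV s i × InV s j)
  × ((i j : Fin n) → InE s i j → InE s j i)
  × (∃ λ i → InV s i)
  × ((i j : Fin n) → InV s i → InV s j → Walk (InE s) i j)

-- core index: F G ≡ k  is expressed as  HasCount (IsConnSub G) k

IsConnLabeled : (i : ℕ) → Vec (Vec Bool i) i → Set
IsConnLabeled i es =
  ((a b : Fin i) → lookup (lookup es a) b ≡ lookup (lookup es b) a)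
  × ((a : Fin i) → lookup (lookup es a) a ≡ false)
  × ((a b : Fin i) → Walk (λ x y → lookup (lookup es x) y ≡ true) a b)

sum1to : ℕ → (ℕ → ℕ) → ℕ
sum1to zero    f = 0
sum1to (suc m) f = sum1to m f + f (suc m)

Mbound : ℕ → (ℕ → ℕ) → ℕ
Mbound n h = sum1to n (λ i → (n C i) * h i)

private
  ≟-sym : ∀ {n} (i j : Fin n) → ⌊ i ≟ j ⌋ ≡ ⌊ j ≟ i ⌋
  ≟-sym i j with i ≟ j | j ≟ i
  ... | yes _ | yes _ = refl
  ... | no _  | no _  = refl
  ... | yes p | no q  = ⊥-elim (q (sym p))
  ... | no p  | yes q = ⊥-elim (p (sym q))

  ≟-refl : ∀ {n} (i : Fin n) → ⌊ i ≟ i ⌋ ≡ true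
  ≟-refl i with i ≟ i
  ... | yes _ = refl
  ... | no p  = ⊥-elim (p refl)

  succ≢ : ∀ m → (suc m ≡ᵇ m) ≡ false
  succ≢ zero    = refl
  succ≢ (suc m) = succ≢ m

Complete : (n : ℕ) → Graph n
Complete n = record
  { adj    = λ i j → not ⌊ i ≟ j ⌋
  ; adj-sym = λ i j → cong not (≟-sym i j)
  ; irrefl = λ i → cong not (≟-refl i)
  }

Path : (n : ℕ) → Graph n
Path n = record
  { adj    = λ i j → (suc (toℕ i) ≡ᵇ toℕ j) ∨ (suc (toℕ j) ≡ᵇ toℕ i)
  ; adj-sym = λ i j → ∨-comm (suc (toℕ i) ≡ᵇ toℕ j) (suc (toℕ j) ≡ᵇ toℕ i)
  ; irrefl = λ i → cong (λ b → b ∨ b) (succ≢ (toℕ i))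
  }

-- Upper bound.  For a vertex set S with |S| = c, the connected subgraphs of
-- Kₙ with vertex set S are exactly the relabellings, along the increasing
-- enumeration of S, of the connected labelled graphs on c vertices.  Running
-- over all S gives a duplicate-free list of the connected subgraphs of Kₙ of
-- length Σ_S h_{|S|} = M.  The connected subgraphs of G are the members of
-- that list whose edges lie in G, so filtering it counts them and F(G) ≤ M.
--
-- Lower bound.  As G is connected, its vertices can be ordered v₁,…,vₙ so
-- that every Pₖ = {v₁,…,vₖ} induces a connected subgraph.  Growing from vₖ
-- inside Pₖ yields connected induced subgraphs containing vₖ of every size
-- 1,…,k; none of them occurred at an earlier stage, so F(G) ≥ Σₖ k.
--
-- Path.  Every connected subgraph of Pₙ is the subgraph induced on an
-- interval of vertices, and there are C(n+1,2) intervals.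
module Submission where

open import Defs
open import Data.Nat using (ℕ; zero; suc; pred; _+_; _*_; _∸_; _≤_; _<_; z≤n; s≤s; _≤ᵇ_; _≡ᵇ_)
open import Data.Nat.Properties
open import Data.Nat.Combinatorics using (_C_; nCk+nC[k+1]≡[n+1]C[k+1]; nC1≡n; k>n⇒nCk≡0)
open import Data.Vec using (Vec; []; _∷_; lookup; tabulate; _[_]≔_)
open import Data.Vec.Properties using (lookup∘tabulate; tabulate∘lookup; tabulate-cong; lookup∘update; lookup∘update′; lookup-replicate; ∷-injectiveʳ; []=⇒lookup; lookup⇒[]=)
open import Data.Bool using (Bool; true; false; _∧_; T)
open import Data.Bool.Properties using (∧-conicalˡ; ∧-conicalʳ; T-≡) renaming (_≟_ to _≟B_)
open import Data.Fin using (Fin; toℕ; inject₁; fromℕ<) renaming (zero to fz; suc to fs)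
open import Data.Fin.Properties using (toℕ-injective; toℕ-inject₁; toℕ<n; all?; any?) renaming (_≟_ to _≟F_)
open import Data.Fin.Subset using (Subset; ∣_∣; ⊤; ⁅_⁆)
open import Data.Fin.Subset.Properties using (∣⊤∣≡n; ∣⁅x⁆∣≡1; x∈⁅x⁆; x∈⁅y⁆⇒x≡y)
open import Data.List using (List; []; _∷_; _++_; length; map; filter; upTo)
open import Data.Nat.ListAction using (sum)
open import Data.Nat.ListAction.Properties using (sum-++)
open import Data.List.Properties using (length-++; length-map; length-filter; length-upTo; length-removeAt′; map-++; map-∘)
open import Data.List.Membership.Propositional using (_∈_)
open import Data.List.Membership.Propositional.Properties using (∈-map⁺; ∈-map⁻; ∈-++⁺ˡ; ∈-++⁺ʳ; ∈-++⁻; ∈-filter⁺; ∈-filter⁻; ∈-upTo⁺)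
open import Data.List.Relation.Unary.Any using (here; there; index) renaming (_─_ to _without_)
open import Data.List.Relation.Unary.All using ([]; _∷_) renaming (lookup to All-lookup; tabulate to All-tabulate)
open import Data.List.Relation.Unary.Unique.Propositional using (Unique; []; _∷_)
import Data.List.Relation.Unary.Unique.Propositional.Properties as Unique
open import Data.Maybe as Maybe using (Maybe; just; nothing)
open import Data.Product using (Σ; _×_; _,_; proj₁; proj₂)
open import Data.Sum using (_⊎_; inj₁; inj₂)
open import Data.Empty using (⊥-elim)
open import Function using (_∘_; _∋_)
open import Function.Bundles using (mk⇔; Equivalence)
open import Relation.Nullary using (¬_; Dec; yes; no)
open import Relation.Nullary.Decidable using (_→-dec_)
open import Algebra.Properties.CommutativeSemigroup +-commutativeSemigroup using () renaming (interchange to +-interchange)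
open import Relation.Binary.PropositionalEquality using (_≡_; _≢_; refl; sym; trans; cong; cong₂; subst; subst₂; module ≡-Reasoning)

module _ {A : Set} where

  ∈-without : {x z : A} {ys : List A} (p : x ∈ ys) → z ∈ ys → z ≢ x → z ∈ (ys without p)
  ∈-without (here refl) (here refl) z≢x = ⊥-elim (z≢x refl)
  ∈-without (here refl) (there q)   z≢x = q
  ∈-without (there p)   (here refl) z≢x = here refl
  ∈-without (there p)   (there q)   z≢x = there (∈-without p q z≢x)

  unique-⊆⇒length-≤ : (xs ys : List A) → Unique xs → (∀ {z} → z ∈ xs → z ∈ ys) → length xs ≤ length ys
  unique-⊆⇒length-≤ []       ys _            _  = z≤n
  unique-⊆⇒length-≤ (x ∷ xs) ys (x∉xs ∷ uxs) xs⊆ys =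
    subst (suc (length xs) ≤_) (sym (length-removeAt′ ys (index x∈ys)))
      (s≤s (unique-⊆⇒length-≤ xs (ys without x∈ys) uxs
        (λ z∈xs → ∈-without x∈ys (xs⊆ys (there z∈xs)) (λ z≡x → All-lookup x∉xs z∈xs (sym z≡x)))))
    where
    x∈ys : x ∈ ys
    x∈ys = xs⊆ys (here refl)

  count-≥-unique : {P : A → Set} {k : ℕ} → HasCount P k →
    (xs : List A) → Unique xs → (∀ {x} → x ∈ xs → P x) → length xs ≤ k
  count-≥-unique (ys , len , _ , ∈⇔P) xs uxs xs⊆P =
    subst (length xs ≤_) len (unique-⊆⇒length-≤ xs ys uxs (λ x∈xs → Equivalence.from (∈⇔P _) (xs⊆P x∈xs)))

  count-≤-covering : {P : A → Set} {k : ℕ} → HasCount P k →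
    (ys : List A) → (∀ {x} → P x → x ∈ ys) → k ≤ length ys
  count-≤-covering (xs , len , uxs , ∈⇔P) ys P⊆ys =
    subst (_≤ length ys) len (unique-⊆⇒length-≤ xs ys uxs (λ x∈xs → P⊆ys (Equivalence.to (∈⇔P _) x∈xs)))

true-ext : {a b : Bool} → (a ≡ true → b ≡ true) → (b ≡ true → a ≡ true) → a ≡ b
true-ext {false} {false} _ _ = refl
true-ext {false} {true}  _ g = g refl
true-ext {true}  {false} f _ = sym (f refl)
true-ext {true}  {true}  _ _ = refl

true-∧ : {a b : Bool} → a ≡ true → b ≡ true → a ∧ b ≡ true
true-∧ refl refl = refl

Mat : ℕ → Set
Mat n = Vec (Vec Bool n) n

entry : {n : ℕ} → Mat n → Fin n → Fin n → Bool
entry M a b = lookup (lookup M a) b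

matrix : {n : ℕ} → (Fin n → Fin n → Bool) → Mat n
matrix f = tabulate (λ a → tabulate (f a))

entry-matrix : {n : ℕ} (f : Fin n → Fin n → Bool) (a b : Fin n) → entry (matrix f) a b ≡ f a b
entry-matrix f a b = begin
  lookup (lookup (matrix f) a) b ≡⟨ cong (λ row → lookup row b) (lookup∘tabulate (λ a → tabulate (f a)) a) ⟩
  lookup (tabulate (f a)) b      ≡⟨ lookup∘tabulate (f a) b ⟩
  f a b                          ∎
  where open ≡-Reasoning

vec-ext : {A : Set} {n : ℕ} (v : Vec A n) {f : Fin n → A} → (∀ i → lookup v i ≡ f i) → v ≡ tabulate f
vec-ext v eq = trans (sym (tabulate∘lookup v)) (tabulate-cong eq)

matrix-ext : {n : ℕ} (M : Mat n) {f : Fin n → Fin n → Bool} → (∀ a b → entry M a b ≡ f a b) → M ≡ matrix f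
matrix-ext M eq = vec-ext M (λ a → vec-ext (lookup M a) (eq a))

module _ {n : ℕ} {R : Fin n → Fin n → Set} where

  walk-map : {S : Fin n → Fin n → Set} → (∀ {a b} → R a b → S a b) → ∀ {i j} → Walk R i j → Walk S i j
  walk-map f here       = here
  walk-map f (step r w) = step (f r) (walk-map f w)

  _++ʷ_ : {i j k : Fin n} → Walk R i j → Walk R j k → Walk R i k
  here     ++ʷ w = w
  step r v ++ʷ w = step r (v ++ʷ w)

  walk-reverse : (∀ {a b} → R a b → R b a) → ∀ {i j} → Walk R i j → Walk R j i
  walk-reverse sym-R here       = here
  walk-reverse sym-R (step r w) = walk-reverse sym-R w ++ʷ step (sym-R r) here

  walk-subst : {i j i′ j′ : Fin n} → i ≡ i′ → j ≡ j′ → Walk R i j → Walk R i′ j′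
  walk-subst refl refl w = w

adj-Complete : {n : ℕ} {i j : Fin n} → i ≢ j → Adj (Complete n) i j
adj-Complete {i = i} {j} i≢j with i ≟F j
... | yes i≡j = ⊥-elim (i≢j i≡j)
... | no  _   = refl

adj⇒≢ : {n : ℕ} (G : Graph n) {i j : Fin n} → Adj G i j → i ≢ j
adj⇒≢ G {i} adj refl with trans (sym adj) (Graph.irrefl G i)
... | ()

_∈ˢ_ : {n : ℕ} → Fin n → Subset n → Set
a ∈ˢ S = lookup S a ≡ true

enum : {n : ℕ} (S : Subset n) → Fin ∣ S ∣ → Fin n
enum (true  ∷ S) fz     = fz
enum (true  ∷ S) (fs x) = fs (enum S x)
enum (false ∷ S) x      = fs (enum S x)

rank : {n : ℕ} (S : Subset n) → Fin n → Maybe (Fin ∣ S ∣)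
rank (true  ∷ S) fz     = just fz
rank (true  ∷ S) (fs a) = Maybe.map fs (rank S a)
rank (false ∷ S) fz     = nothing
rank (false ∷ S) (fs a) = rank S a

rank-enum : {n : ℕ} (S : Subset n) (x : Fin ∣ S ∣) → rank S (enum S x) ≡ just x
rank-enum (true  ∷ S) fz     = refl
rank-enum (true  ∷ S) (fs x) = cong (Maybe.map fs) (rank-enum S x)
rank-enum (false ∷ S) x      = rank-enum S x

enum-rank : {n : ℕ} (S : Subset n) {a : Fin n} {x : Fin ∣ S ∣} → rank S a ≡ just x → enum S x ≡ a
enum-rank (true  ∷ S) {fz}   refl = refl
enum-rank (true  ∷ S) {fs a} eq with rank S a in ra
enum-rank (true  ∷ S) {fs a} refl | just y = cong fs (enum-rank S ra)
enum-rank (false ∷ S) {fs a} eq = cong fs (enum-rank S eq)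

enum-∈ : {n : ℕ} (S : Subset n) (x : Fin ∣ S ∣) → enum S x ∈ˢ S
enum-∈ (true  ∷ S) fz     = refl
enum-∈ (true  ∷ S) (fs x) = enum-∈ S x
enum-∈ (false ∷ S) x      = enum-∈ S x

rank-nothing⇒∉ : {n : ℕ} (S : Subset n) {a : Fin n} → rank S a ≡ nothing → lookup S a ≡ false
rank-nothing⇒∉ (true  ∷ S) {fs a} eq with rank S a in ra
... | nothing = rank-nothing⇒∉ S ra
rank-nothing⇒∉ (false ∷ S) {fz}   eq = refl
rank-nothing⇒∉ (false ∷ S) {fs a} eq = rank-nothing⇒∉ S eq

rank-just⇒∈ : {n : ℕ} (S : Subset n) {a : Fin n} {x : Fin ∣ S ∣} → rank S a ≡ just x → a ∈ˢ S
rank-just⇒∈ S {x = x} eq = subst (_∈ˢ S) (enum-rank S eq) (enum-∈ S x)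

∈⇒rank : {n : ℕ} (S : Subset n) {a : Fin n} → a ∈ˢ S → Σ (Fin ∣ S ∣) λ x → rank S a ≡ just x
∈⇒rank S {a} a∈S with rank S a in ra
... | just x  = x , refl
... | nothing with trans (sym (rank-nothing⇒∉ S ra)) a∈S
... | ()

-- Transporting edge sets between S and the labelled vertex set Fin |S|:
-- extend S e places the graph e on S (no edges touch vertices outside S),
-- restrict S E reads off the edges of E between elements of S.

liftEntry : {c : ℕ} → Mat c → Maybe (Fin c) → Maybe (Fin c) → Bool
liftEntry e (just x) (just y) = entry e x y
liftEntry e _        _        = false

liftEntry-true : {c : ℕ} (e : Mat c) (p q : Maybe (Fin c)) → liftEntry e p q ≡ true →
  Σ (Fin c) λ x → Σ (Fin c) λ y → (p ≡ just x) × (q ≡ just y) × (entry e x y ≡ true)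
liftEntry-true e (just x) (just y) exy = x , y , refl , refl , exy

extend : {n : ℕ} (S : Subset n) → Mat ∣ S ∣ → Mat n
extend S e = matrix (λ a b → liftEntry e (rank S a) (rank S b))

restrict : {n : ℕ} (S : Subset n) → Mat n → Mat ∣ S ∣
restrict S E = matrix (λ x y → entry E (enum S x) (enum S y))

InsideEdges : {n : ℕ} → Subset n → Mat n → Set
InsideEdges {n} S E = (a b : Fin n) → entry E a b ≡ true → a ∈ˢ S × b ∈ˢ S

Edge : {c : ℕ} → Mat c → Fin c → Fin c → Set
Edge e x y = entry e x y ≡ true

module _ {n : ℕ} (S : Subset n) where

  entry-extend-enum : (e : Mat ∣ S ∣) (x y : Fin ∣ S ∣) → entry (extend S e) (enum S x) (enum S y) ≡ entry e x y
  entry-extend-enum e x y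
    rewrite entry-matrix (λ a b → liftEntry e (rank S a) (rank S b)) (enum S x) (enum S y)
          | rank-enum S x | rank-enum S y = refl

  restrict-extend : (e : Mat ∣ S ∣) → restrict S (extend S e) ≡ e
  restrict-extend e = sym (matrix-ext e λ x y → sym (entry-extend-enum e x y))

  extend-restrict : (E : Mat n) → InsideEdges S E → E ≡ extend S (restrict S E)
  extend-restrict E inside = matrix-ext E λ a b → by-rank a b refl refl
    where
    by-rank : (a b : Fin n) {p q : Maybe (Fin ∣ S ∣)} → rank S a ≡ p → rank S b ≡ q →
      entry E a b ≡ liftEntry (restrict S E) p q
    by-rank a b {just x} {just y} ra rb
      rewrite entry-matrix (λ x y → entry E (enum S x) (enum S y)) x y | enum-rank S ra | enum-rank S rb = refl
    by-rank a b {just x} {nothing} ra rb with entry E a b in eab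
    ... | false = refl
    ... | true with trans (sym (rank-nothing⇒∉ S rb)) (proj₂ (inside a b eab))
    ... | ()
    by-rank a b {nothing} ra rb with entry E a b in eab
    ... | false = refl
    ... | true with trans (sym (rank-nothing⇒∉ S ra)) (proj₁ (inside a b eab))
    ... | ()

  restrict-walk : (E : Mat n) → InsideEdges S E → ∀ {a b} → Walk (InE (S , E)) a b →
    ∀ {x y} → rank S a ≡ just x → rank S b ≡ just y → Walk (Edge (restrict S E)) x y
  restrict-walk E inside here ra rb with trans (sym ra) rb
  ... | refl = here
  restrict-walk E inside (step {a} {a′} eaa′ w) {x} ra rb with ∈⇒rank S (proj₂ (inside _ _ eaa′))
  ... | x′ , ra′ = step edge (restrict-walk E inside w ra′ rb)
    where
    edge : Edge (restrict S E) x x′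
    edge = trans (entry-matrix (λ x y → entry E (enum S x) (enum S y)) x x′)
                 (subst₂ (λ p q → entry E p q ≡ true) (sym (enum-rank S ra)) (sym (enum-rank S ra′)) eaa′)

  extend-walk : (e : Mat ∣ S ∣) → ∀ {x y} → Walk (Edge e) x y → Walk (InE (S , extend S e)) (enum S x) (enum S y)
  extend-walk e here                    = here
  extend-walk e (step {_} {x′} exx′ w) = step (trans (entry-extend-enum e _ x′) exx′) (extend-walk e w)

  -- A connected labelled graph on |S| vertices transported to S is a
  -- connected subgraph of Kₙ (nonempty because |S| ≥ 1).
  extend-connSub : (e : Mat ∣ S ∣) → IsConnLabeled ∣ S ∣ e → Fin ∣ S ∣ → IsConnSub (Complete n) (S , extend S e)
  extend-connSub e (e-sym , e-irrefl , e-conn) x₀ = edges , symm , (enum S x₀ , enum-∈ S x₀) , conn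
    where
    lifted : (a b : Fin n) → InE (S , extend S e) a b →
      Σ (Fin ∣ S ∣) λ x → Σ (Fin ∣ S ∣) λ y → (rank S a ≡ just x) × (rank S b ≡ just y) × (entry e x y ≡ true)
    lifted a b eab = liftEntry-true e (rank S a) (rank S b)
      (trans (sym (entry-matrix (λ a b → liftEntry e (rank S a) (rank S b)) a b)) eab)
    edges : (a b : Fin n) → InE (S , extend S e) a b → Adj (Complete n) a b × a ∈ˢ S × b ∈ˢ S
    edges a b eab with lifted a b eab
    ... | x , y , ra , rb , exy = adj-Complete a≢b , rank-just⇒∈ S ra , rank-just⇒∈ S rb
      where
      a≢b : a ≢ b
      a≢b refl with trans (sym ra) rb
      ... | refl with trans (sym exy) (e-irrefl x)
      ... | ()
    symm : (a b : Fin n) → InE (S , extend S e) a b → InE (S , extend S e) b a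
    symm a b eab with lifted a b eab
    ... | x , y , ra , rb , exy =
      subst₂ (λ p q → entry (extend S e) p q ≡ true) (enum-rank S rb) (enum-rank S ra)
        (trans (entry-extend-enum e y x) (trans (e-sym y x) exy))
    conn : (a b : Fin n) → a ∈ˢ S → b ∈ˢ S → Walk (InE (S , extend S e)) a b
    conn a b a∈S b∈S with ∈⇒rank S a∈S | ∈⇒rank S b∈S
    ... | x , ra | y , rb = walk-subst (enum-rank S ra) (enum-rank S rb) (extend-walk e (e-conn x y))

  restrict-connLabeled : (G : Graph n) (E : Mat n) → IsConnSub G (S , E) → IsConnLabeled ∣ S ∣ (restrict S E)
  restrict-connLabeled G E (edges , symm , _ , conn) = r-sym , r-irrefl , r-conn
    where
    inside : InsideEdges S E
    inside a b eab = proj₂ (edges a b eab)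
    entry-restrict : (x y : Fin ∣ S ∣) → entry (restrict S E) x y ≡ entry E (enum S x) (enum S y)
    entry-restrict = entry-matrix (λ x y → entry E (enum S x) (enum S y))
    r-sym : (x y : Fin ∣ S ∣) → entry (restrict S E) x y ≡ entry (restrict S E) y x
    r-sym x y rewrite entry-restrict x y | entry-restrict y x = true-ext (symm _ _) (symm _ _)
    r-irrefl : (x : Fin ∣ S ∣) → entry (restrict S E) x x ≡ false
    r-irrefl x rewrite entry-restrict x x with entry E (enum S x) (enum S x) in exx
    ... | false = refl
    ... | true  = ⊥-elim (adj⇒≢ G (proj₁ (edges _ _ exx)) refl)
    r-conn : (x y : Fin ∣ S ∣) → Walk (Edge (restrict S E)) x y
    r-conn x y = restrict-walk E inside (conn _ _ (enum-∈ S x) (enum-∈ S y)) (rank-enum S x) (rank-enum S y)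

allSubsets : (n : ℕ) → List (Subset n)
allSubsets zero    = [] ∷ []
allSubsets (suc n) = map (true ∷_) (allSubsets n) ++ map (false ∷_) (allSubsets n)

∈-allSubsets : {n : ℕ} (S : Subset n) → S ∈ allSubsets n
∈-allSubsets []                  = here refl
∈-allSubsets {suc n} (true  ∷ S) = ∈-++⁺ˡ (∈-map⁺ (true ∷_) (∈-allSubsets S))
∈-allSubsets {suc n} (false ∷ S) = ∈-++⁺ʳ (map (true ∷_) (allSubsets n)) (∈-map⁺ (false ∷_) (∈-allSubsets S))

allSubsets-unique : (n : ℕ) → Unique (allSubsets n)
allSubsets-unique zero    = [] ∷ []
allSubsets-unique (suc n) =
  Unique.++⁺ (Unique.map⁺ ∷-injectiveʳ (allSubsets-unique n)) (Unique.map⁺ ∷-injectiveʳ (allSubsets-unique n)) disjoint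
  where
  disjoint : ∀ {S} → ¬ ((S ∈ map (true ∷_) (allSubsets n)) × (S ∈ map (false ∷_) (allSubsets n)))
  disjoint (p , q) with ∈-map⁻ (true ∷_) p | ∈-map⁻ (false ∷_) q
  ... | _ , _ , refl | _ , _ , ()

sum1to-cong : (m : ℕ) {f g : ℕ → ℕ} → (∀ j → f (suc j) ≡ g (suc j)) → sum1to m f ≡ sum1to m g
sum1to-cong zero    eq = refl
sum1to-cong (suc m) eq = cong₂ _+_ (sum1to-cong m eq) (eq m)

sum1to-+ : (m : ℕ) (f g : ℕ → ℕ) → sum1to m (λ i → f i + g i) ≡ sum1to m f + sum1to m g
sum1to-+ zero    f g = refl
sum1to-+ (suc m) f g =
  trans (cong (_+ (f (suc m) + g (suc m))) (sum1to-+ m f g))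
        (+-interchange (sum1to m f) (sum1to m g) (f (suc m)) (g (suc m)))

sum1to-shift : (m : ℕ) (f : ℕ → ℕ) → sum1to (suc m) f ≡ f 1 + sum1to m (f ∘ suc)
sum1to-shift zero    f = sym (+-identityʳ (f 1))
sum1to-shift (suc m) f = trans (cong (_+ f (suc (suc m))) (sum1to-shift m f)) (+-assoc (f 1) _ _)

-- Pascal's rule, summed: the subsets of Fin (n+1) containing 0 and those
-- avoiding it recombine into Σ_{i=1}^{n+1} C(n+1,i) f i.
pascal-sum : (n : ℕ) (f : ℕ → ℕ) →
  (f 1 + sum1to n (λ i → (n C i) * f (suc i))) + (f 0 + sum1to n (λ i → (n C i) * f i))
    ≡ f 0 + sum1to (suc n) (λ i → (suc n C i) * f i)
pascal-sum n f = begin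
  (f 1 + A) + (f 0 + B)                   ≡⟨ +-comm (f 1 + A) (f 0 + B) ⟩
  (f 0 + B) + (f 1 + A)                   ≡⟨ +-assoc (f 0) B (f 1 + A) ⟩
  f 0 + (B + (f 1 + A))                   ≡⟨ cong (f 0 +_) (+-comm B (f 1 + A)) ⟩
  f 0 + ((f 1 + A) + B)                   ≡⟨ cong (λ t → f 0 + (t + B)) (sym lower-shift) ⟩
  f 0 + (sum1to (suc n) lower + B)        ≡⟨ cong (λ t → f 0 + (sum1to (suc n) lower + t)) (sym top-vanishes) ⟩
  f 0 + (sum1to (suc n) lower + sum1to (suc n) upper)
                                          ≡⟨ cong (f 0 +_) (sym (sum1to-+ (suc n) lower upper)) ⟩
  f 0 + sum1to (suc n) (λ i → lower i + upper i)
                                          ≡⟨ cong (f 0 +_) (sum1to-cong (suc n) pascal) ⟩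
  f 0 + sum1to (suc n) (λ i → (suc n C i) * f i) ∎
  where
  open ≡-Reasoning
  A B : ℕ
  A = sum1to n (λ i → (n C i) * f (suc i))
  B = sum1to n (λ i → (n C i) * f i)
  lower upper : ℕ → ℕ
  lower i = (n C pred i) * f i
  upper i = (n C i) * f i
  lower-shift : sum1to (suc n) lower ≡ f 1 + A
  lower-shift = trans (sum1to-shift n lower) (cong (_+ A) (+-identityʳ (f 1)))
  top-vanishes : sum1to (suc n) upper ≡ B
  top-vanishes = trans (cong (λ t → B + t * f (suc n)) (k>n⇒nCk≡0 {n} {suc n} ≤-refl)) (+-identityʳ B)
  pascal : ∀ j → lower (suc j) + upper (suc j) ≡ (suc n C suc j) * f (suc j)
  pascal j = trans (sym (*-distribʳ-+ (f (suc j)) (n C j) (n C suc j)))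
                   (cong (_* f (suc j)) (nCk+nC[k+1]≡[n+1]C[k+1] n j))

subset-size-sum : (n : ℕ) (f : ℕ → ℕ) → sum (map (f ∘ ∣_∣) (allSubsets n)) ≡ f 0 + sum1to n (λ i → (n C i) * f i)
subset-size-sum zero    f = refl
subset-size-sum (suc n) f = begin
  sum (map (f ∘ ∣_∣) (map (true ∷_) Ss ++ map (false ∷_) Ss))
    ≡⟨ cong sum (map-++ (f ∘ ∣_∣) (map (true ∷_) Ss) (map (false ∷_) Ss)) ⟩
  sum (map (f ∘ ∣_∣) (map (true ∷_) Ss) ++ map (f ∘ ∣_∣) (map (false ∷_) Ss))
    ≡⟨ sum-++ (map (f ∘ ∣_∣) (map (true ∷_) Ss)) _ ⟩
  sum (map (f ∘ ∣_∣) (map (true ∷_) Ss)) + sum (map (f ∘ ∣_∣) (map (false ∷_) Ss))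
    ≡⟨ cong₂ (λ xs ys → sum xs + sum ys) (sym (map-∘ Ss)) (sym (map-∘ Ss)) ⟩
  sum (map (f ∘ suc ∘ ∣_∣) Ss) + sum (map (f ∘ ∣_∣) Ss)
    ≡⟨ cong₂ _+_ (subset-size-sum n (f ∘ suc)) (subset-size-sum n f) ⟩
  (f 1 + sum1to n (λ i → (n C i) * f (suc i))) + (f 0 + sum1to n (λ i → (n C i) * f i))
    ≡⟨ pascal-sum n f ⟩
  f 0 + sum1to (suc n) (λ i → (suc n C i) * f i) ∎
  where
  open ≡-Reasoning
  Ss : List (Subset n)
  Ss = allSubsets n

module CompleteGraph (h : ℕ → ℕ) (labelled-count : (i : ℕ) → HasCount (IsConnLabeled i) (h i)) (n : ℕ) where

  -- The connected labelled graphs on c vertices; for c = 0 the list is empty,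
  -- since a subgraph has at least one vertex.
  labelled : (c : ℕ) → List (Mat c)
  labelled zero    = []
  labelled (suc c) = proj₁ (labelled-count (suc c))

  labelled-length : (c : ℕ) → length (labelled (suc c)) ≡ h (suc c)
  labelled-length c = proj₁ (proj₂ (labelled-count (suc c)))

  labelled-unique : (c : ℕ) → Unique (labelled c)
  labelled-unique zero    = []
  labelled-unique (suc c) = proj₁ (proj₂ (proj₂ (labelled-count (suc c))))

  labelled-sound : (c : ℕ) {e : Mat c} → e ∈ labelled c → IsConnLabeled c e × Fin c
  labelled-sound (suc c) {e} e∈ = Equivalence.to (proj₂ (proj₂ (proj₂ (labelled-count (suc c)))) e) e∈ , fz

  labelled-complete : (c : ℕ) {e : Mat c} → Fin c → IsConnLabeled c e → e ∈ labelled c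
  labelled-complete (suc c) {e} _ conn = Equivalence.from (proj₂ (proj₂ (proj₂ (labelled-count (suc c)))) e) conn

  connSubsOn : Subset n → List (SubData n)
  connSubsOn S = map (λ e → S , extend S e) (labelled ∣ S ∣)

  connSubsOver : List (Subset n) → List (SubData n)
  connSubsOver []       = []
  connSubsOver (S ∷ Ss) = connSubsOn S ++ connSubsOver Ss

  connSubsK : List (SubData n)
  connSubsK = connSubsOver (allSubsets n)

  connSubsOver-length : (Ss : List (Subset n)) → length (connSubsOver Ss) ≡ sum (map (length ∘ labelled ∘ ∣_∣) Ss)
  connSubsOver-length []       = refl
  connSubsOver-length (S ∷ Ss) =
    trans (length-++ (connSubsOn S)) (cong₂ _+_ (length-map _ (labelled ∣ S ∣)) (connSubsOver-length Ss))

  connSubsK-length : length connSubsK ≡ Mbound n h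
  connSubsK-length = begin
    length connSubsK                                       ≡⟨ connSubsOver-length (allSubsets n) ⟩
    sum (map (length ∘ labelled ∘ ∣_∣) (allSubsets n))     ≡⟨ subset-size-sum n (length ∘ labelled) ⟩
    sum1to n (λ i → (n C i) * length (labelled i))         ≡⟨ sum1to-cong n (λ j → cong ((n C suc j) *_) (labelled-length j)) ⟩
    Mbound n h                                             ∎
    where open ≡-Reasoning

  -- No duplicates: extend S is injective, and different S give different vertex sets.
  connSubsOver-vertexSet : (Ss : List (Subset n)) {s : SubData n} → s ∈ connSubsOver Ss → proj₁ s ∈ Ss
  connSubsOver-vertexSet (S ∷ Ss) s∈ with ∈-++⁻ (connSubsOn S) s∈
  ... | inj₂ s∈rest = there (connSubsOver-vertexSet Ss s∈rest)
  ... | inj₁ s∈S with ∈-map⁻ (λ e → S , extend S e) s∈S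
  ...   | _ , _ , refl = here refl

  connSubsOn-unique : (S : Subset n) → Unique (connSubsOn S)
  connSubsOn-unique S = Unique.map⁺ injective (labelled-unique ∣ S ∣)
    where
    injective : ∀ {e e′} → (SubData n ∋ (S , extend S e)) ≡ (S , extend S e′) → e ≡ e′
    injective {e} {e′} eq =
      trans (sym (restrict-extend S e)) (trans (cong (restrict S ∘ proj₂) eq) (restrict-extend S e′))

  connSubsOver-unique : (Ss : List (Subset n)) → Unique Ss → Unique (connSubsOver Ss)
  connSubsOver-unique []       _            = []
  connSubsOver-unique (S ∷ Ss) (S∉Ss ∷ uSs) =
    Unique.++⁺ (connSubsOn-unique S) (connSubsOver-unique Ss uSs) disjoint
    where
    disjoint : ∀ {s} → ¬ ((s ∈ connSubsOn S) × (s ∈ connSubsOver Ss))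
    disjoint (p , q) with ∈-map⁻ (λ e → S , extend S e) p
    ... | _ , _ , refl = All-lookup S∉Ss (connSubsOver-vertexSet Ss q) refl

  connSubsK-sound : {s : SubData n} → s ∈ connSubsK → IsConnSub (Complete n) s
  connSubsK-sound = go (allSubsets n)
    where
    go : (Ss : List (Subset n)) {s : SubData n} → s ∈ connSubsOver Ss → IsConnSub (Complete n) s
    go (S ∷ Ss) s∈ with ∈-++⁻ (connSubsOn S) s∈
    ... | inj₂ s∈rest = go Ss s∈rest
    ... | inj₁ s∈S with ∈-map⁻ (λ e → S , extend S e) s∈S
    ...   | e , e∈ , refl = extend-connSub S e (proj₁ (labelled-sound ∣ S ∣ e∈)) (proj₂ (labelled-sound ∣ S ∣ e∈))

  -- Completeness: a connected subgraph (S, E) of any graph on Fin n is listed,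
  -- as the transport of its restriction to S.
  connSubsK-complete : (G : Graph n) (s : SubData n) → IsConnSub G s → s ∈ connSubsK
  connSubsK-complete G (S , E) conn@(edges , _ , (a₀ , a₀∈S) , _) =
    over (allSubsets n) (∈-allSubsets S)
      (subst (λ M → (S , M) ∈ connSubsOn S) (sym (extend-restrict S E (λ a b eab → proj₂ (edges a b eab))))
        (∈-map⁺ (λ e → S , extend S e) restriction∈))
    where
    restriction∈ : restrict S E ∈ labelled ∣ S ∣
    restriction∈ = labelled-complete ∣ S ∣ (proj₁ (∈⇒rank S a₀∈S)) (restrict-connLabeled S G E conn)
    over : (Ss : List (Subset n)) {s : SubData n} → S ∈ Ss → s ∈ connSubsOn S → s ∈ connSubsOver Ss
    over (S ∷ Ss) (here refl) s∈ = ∈-++⁺ˡ s∈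
    over (T ∷ Ss) (there S∈)  s∈ = ∈-++⁺ʳ (connSubsOn T) (over Ss S∈ s∈)

  count-Complete : HasCount (IsConnSub (Complete n)) (Mbound n h)
  count-Complete = connSubsK , connSubsK-length , connSubsOver-unique (allSubsets n) (allSubsets-unique n) ,
                   λ s → mk⇔ connSubsK-sound (connSubsK-complete (Complete n) s)

  module _ (G : Graph n) where

    EdgesIn : SubData n → Set
    EdgesIn s = (i j : Fin n) → InE s i j → Adj G i j

    edgesIn? : (s : SubData n) → Dec (EdgesIn s)
    edgesIn? s = all? λ i → all? λ j → (entry (proj₂ s) i j ≟B true) →-dec (Graph.adj G i j ≟B true)

    connSubs : List (SubData n)
    connSubs = filter edgesIn? connSubsK

    connSubs-sound : {s : SubData n} → s ∈ connSubs → IsConnSub G s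
    connSubs-sound s∈ with ∈-filter⁻ edgesIn? s∈
    ... | s∈K , inG with connSubsK-sound s∈K
    ...   | edges , symm , nonempty , conn = (λ i j e → inG i j e , proj₂ (edges i j e)) , symm , nonempty , conn

    connSubs-complete : (s : SubData n) → IsConnSub G s → s ∈ connSubs
    connSubs-complete s conn = ∈-filter⁺ edgesIn? (connSubsK-complete G s conn) (λ i j e → proj₁ (proj₁ conn i j e))

    count : HasCount (IsConnSub G) (length connSubs)
    count = connSubs , refl , Unique.filter⁺ edgesIn? (proj₁ (proj₂ (proj₂ count-Complete))) ,
            λ s → mk⇔ connSubs-sound (connSubs-complete s)

    count-≤-M : length connSubs ≤ Mbound n h
    count-≤-M = subst (length connSubs ≤_) connSubsK-length (length-filter edgesIn? connSubsK)

insert : {n : ℕ} → Subset n → Fin n → Subset n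
insert S v = S [ v ]≔ true

_⊆ˢ_ : {n : ℕ} → Subset n → Subset n → Set
_⊆ˢ_ {n} S T = (a : Fin n) → a ∈ˢ S → a ∈ˢ T

module _ {n : ℕ} (S : Subset n) (v : Fin n) where

  ∈-insert : v ∈ˢ insert S v
  ∈-insert = lookup∘update v S true

  ⊆-insert : S ⊆ˢ insert S v
  ⊆-insert c c∈S with c ≟F v
  ... | yes refl = ∈-insert
  ... | no  c≢v  = trans (lookup∘update′ c≢v S true) c∈S

  ∈-insert⁻ : {c : Fin n} → c ∈ˢ insert S v → c ≡ v ⊎ c ∈ˢ S
  ∈-insert⁻ {c} c∈ with c ≟F v
  ... | yes c≡v = inj₁ c≡v
  ... | no  c≢v = inj₂ (trans (sym (lookup∘update′ c≢v S true)) c∈)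

∣insert∣ : {n : ℕ} (S : Subset n) (v : Fin n) → lookup S v ≡ false → ∣ insert S v ∣ ≡ suc ∣ S ∣
∣insert∣ (false ∷ S) fz     _    = refl
∣insert∣ (true  ∷ S) (fs v) v∉S = cong suc (∣insert∣ S v v∉S)
∣insert∣ (false ∷ S) (fs v) v∉S = ∣insert∣ S v v∉S

new-element : {n : ℕ} (S W : Subset n) → S ⊆ˢ W → ∣ S ∣ < ∣ W ∣ → Σ (Fin n) λ v → v ∈ˢ W × lookup S v ≡ false
new-element (false ∷ S) (true  ∷ W) _    _          = fz , refl , refl
new-element (true  ∷ S) (true  ∷ W) S⊆W (s≤s S<W) with new-element S W (S⊆W ∘ fs) S<W
... | v , v∈W , v∉S = fs v , v∈W , v∉S
new-element (false ∷ S) (false ∷ W) S⊆W S<W with new-element S W (S⊆W ∘ fs) S<W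
... | v , v∈W , v∉S = fs v , v∈W , v∉S
new-element (true  ∷ S) (false ∷ W) S⊆W _ with S⊆W fz refl
... | ()

nonempty : {n : ℕ} (S : Subset n) → 0 < ∣ S ∣ → Σ (Fin n) (_∈ˢ S)
nonempty (true  ∷ S) _  = fz , refl
nonempty (false ∷ S) 0<S with nonempty S 0<S
... | v , v∈S = fs v , v∈S

∈-⁅⁆ : {n : ℕ} (w : Fin n) → w ∈ˢ ⁅ w ⁆
∈-⁅⁆ w = []=⇒lookup (x∈⁅x⁆ w)

∈-⁅⁆⁻ : {n : ℕ} (w : Fin n) {c : Fin n} → c ∈ˢ ⁅ w ⁆ → c ≡ w
∈-⁅⁆⁻ w {c} c∈ = x∈⁅y⁆⇒x≡y w (lookup⇒[]= c ⁅ w ⁆ c∈)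

module Induced {n : ℕ} (G : Graph n) where

  EdgeIn : Subset n → Fin n → Fin n → Set
  EdgeIn S a b = Adj G a b × a ∈ˢ S × b ∈ˢ S

  EdgeIn-sym : {S : Subset n} {a b : Fin n} → EdgeIn S a b → EdgeIn S b a
  EdgeIn-sym {S} {a} {b} (ab , a∈S , b∈S) = trans (Graph.adj-sym G b a) ab , b∈S , a∈S

  Linked : Subset n → Set
  Linked S = (a b : Fin n) → a ∈ˢ S → b ∈ˢ S → Walk (EdgeIn S) a b

  ⁅⁆-linked : (w : Fin n) → Linked ⁅ w ⁆
  ⁅⁆-linked w c d c∈ d∈ with ∈-⁅⁆⁻ w c∈ | ∈-⁅⁆⁻ w d∈
  ... | refl | refl = here

  inducedEntry : Subset n → Fin n → Fin n → Bool
  inducedEntry S a b = lookup S a ∧ (lookup S b ∧ Graph.adj G a b)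

  inducedEntry⁻ : {S : Subset n} {a b : Fin n} → inducedEntry S a b ≡ true → EdgeIn S a b
  inducedEntry⁻ {S} {a} {b} e = ∧-conicalʳ _ _ rest , ∧-conicalˡ _ _ e , ∧-conicalˡ _ _ rest
    where
    rest : (lookup S b ∧ Graph.adj G a b) ≡ true
    rest = ∧-conicalʳ (lookup S a) _ e

  inducedEntry⁺ : {S : Subset n} {a b : Fin n} → EdgeIn S a b → inducedEntry S a b ≡ true
  inducedEntry⁺ (ab , a∈S , b∈S) = true-∧ a∈S (true-∧ b∈S ab)

  induced : Subset n → SubData n
  induced S = S , matrix (inducedEntry S)

  induced-edge : {S : Subset n} (a b : Fin n) → InE (induced S) a b → EdgeIn S a b
  induced-edge {S} a b e = inducedEntry⁻ {S} (trans (sym (entry-matrix (inducedEntry S) a b)) e)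

  induced-edge⁺ : {S : Subset n} {a b : Fin n} → EdgeIn S a b → InE (induced S) a b
  induced-edge⁺ {S} {a} {b} e = trans (entry-matrix (inducedEntry S) a b) (inducedEntry⁺ {S} e)

  induced-connSub : (S : Subset n) → Linked S → Σ (Fin n) (_∈ˢ S) → IsConnSub G (induced S)
  induced-connSub S linked a₀ =
    induced-edge {S} , (λ a b e → induced-edge⁺ {S} (EdgeIn-sym {S} (induced-edge {S} a b e))) , a₀ ,
    λ a b a∈S b∈S → walk-map (induced-edge⁺ {S}) (linked a b a∈S b∈S)

module LowerBound {n : ℕ} (G : Graph n) (G-connected : Connected G) where
  open Induced G

  exit-edge : (S W : Subset n) {x y : Fin n} → Walk (EdgeIn W) x y → x ∈ˢ S → lookup S y ≡ false →
    Σ (Fin n) λ a → Σ (Fin n) λ b → EdgeIn W a b × a ∈ˢ S × lookup S b ≡ false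
  exit-edge S W here x∈S y∉S with trans (sym x∈S) y∉S
  ... | ()
  exit-edge S W (step {x} {x′} e w) x∈S y∉S with lookup S x′ in x′∈S
  ... | true  = exit-edge S W w x′∈S y∉S
  ... | false = x , x′ , e , x∈S , x′∈S

  insert-linked : (S : Subset n) {a b : Fin n} → Linked S → Adj G a b → a ∈ˢ S → Linked (insert S b)
  insert-linked S {a} {b} linked ab a∈S c d c∈ d∈ = to-a c c∈ ++ʷ walk-reverse (EdgeIn-sym {insert S b}) (to-a d d∈)
    where
    to-a : (c : Fin n) → c ∈ˢ insert S b → Walk (EdgeIn (insert S b)) c a
    to-a c c∈ with ∈-insert⁻ S b c∈
    ... | inj₁ refl = step (trans (Graph.adj-sym G c a) ab , ∈-insert S c , ⊆-insert S c a a∈S) here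
    ... | inj₂ c∈S  = walk-map (λ (e , x∈ , y∈) → e , ⊆-insert S b _ x∈ , ⊆-insert S b _ y∈) (linked c a c∈S a∈S)

  grow : (W S : Subset n) → Linked W → Linked S → S ⊆ˢ W → Σ (Fin n) (_∈ˢ S) → ∣ S ∣ < ∣ W ∣ →
    Σ (Fin n) λ v → lookup S v ≡ false × v ∈ˢ W × Linked (insert S v)
  grow W S W-linked S-linked S⊆W (s₀ , s₀∈S) S<W with new-element S W S⊆W S<W
  ... | v , v∈W , v∉S with exit-edge S W (W-linked s₀ v (S⊆W s₀ s₀∈S) v∈W) s₀∈S v∉S
  ...   | a , b , (ab , _ , b∈W) , a∈S , b∉S = b , b∉S , b∈W , insert-linked S S-linked ab a∈S

  grow-to : (W : Subset n) → Linked W → (w : Fin n) → w ∈ˢ W → (j : ℕ) → suc j ≤ ∣ W ∣ →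
    Σ (Subset n) λ Q → Q ⊆ˢ W × w ∈ˢ Q × Linked Q × ∣ Q ∣ ≡ suc j
  grow-to W W-linked w w∈W zero _ =
    ⁅ w ⁆ , (λ c c∈ → subst (_∈ˢ W) (sym (∈-⁅⁆⁻ w c∈)) w∈W) , ∈-⁅⁆ w , ⁅⁆-linked w , ∣⁅x⁆∣≡1 w
  grow-to W W-linked w w∈W (suc j) j<W with grow-to W W-linked w w∈W j (≤-trans (n≤1+n _) j<W)
  ... | Q , Q⊆W , w∈Q , Q-linked , ∣Q∣≡ with grow W Q W-linked Q-linked Q⊆W (w , w∈Q) (subst (λ k → suc k ≤ ∣ W ∣) (sym ∣Q∣≡) j<W)
  ...   | v , v∉Q , v∈W , Qv-linked =
    insert Q v , Qv⊆W , ⊆-insert Q v w w∈Q , Qv-linked , trans (∣insert∣ Q v v∉Q) (cong suc ∣Q∣≡)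
    where
    Qv⊆W : insert Q v ⊆ˢ W
    Qv⊆W c c∈ with ∈-insert⁻ Q v c∈
    ... | inj₁ refl = v∈W
    ... | inj₂ c∈Q  = Q⊆W c c∈Q

  Through : Subset n → Fin n → ℕ → SubData n → Set
  Through P v j s = IsConnSub G s × proj₁ s ⊆ˢ P × v ∈ˢ proj₁ s × ∣ proj₁ s ∣ ≤ j

  -- There are j distinct ones (the induced subgraphs of sizes 1,…,j).
  through : (P : Subset n) → Linked P → (v : Fin n) → v ∈ˢ P → (j : ℕ) → j ≤ ∣ P ∣ →
    Σ (List (SubData n)) λ L → Unique L × length L ≡ j × (∀ {s} → s ∈ L → Through P v j s)
  through P P-linked v v∈P zero    _   = [] , [] , refl , λ ()
  through P P-linked v v∈P (suc j) j<P
    with grow-to P P-linked v v∈P j j<P | through P P-linked v v∈P j (≤-trans (n≤1+n j) j<P)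
  ... | Q , Q⊆P , v∈Q , Q-linked , ∣Q∣≡ | L , uL , len , L-through =
    induced Q ∷ L , All-tabulate new ∷ uL , cong suc len , through-Q∷L
    where
    new : ∀ {s} → s ∈ L → induced Q ≢ s
    new s∈L refl with L-through s∈L
    ... | _ , _ , _ , Q≤j = <-irrefl refl (subst (_≤ j) ∣Q∣≡ Q≤j)
    through-Q∷L : ∀ {s} → s ∈ induced Q ∷ L → Through P v (suc j) s
    through-Q∷L (here refl) = induced-connSub Q Q-linked (v , v∈Q) , Q⊆P , v∈Q , ≤-reflexive ∣Q∣≡
    through-Q∷L (there s∈L) with L-through s∈L
    ... | conn , s⊆P , v∈s , s≤j = conn , s⊆P , v∈s , m≤n⇒m≤1+n s≤j

  record Stage (m : ℕ) : Set where
    constructor mkStage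
    field
      P         : Subset n
      linked    : Linked P
      size      : ∣ P ∣ ≡ suc m
      found     : List (SubData n)
      unique    : Unique found
      sound     : ∀ {s} → s ∈ found → IsConnSub G s × proj₁ s ⊆ˢ P
      found-len : length found ≡ suc (suc m) C 2

  ⊤-linked : Linked ⊤
  ⊤-linked a b _ _ = walk-map (λ {x} {y} xy → xy , lookup-replicate x true , lookup-replicate y true) (G-connected a b)

  -- From stage m to m+1: add a vertex v adjacent to P; the connected subgraphs
  -- through v inside P ∪ {v} with 1,…,m+2 vertices are all new.
  next-stage : (m : ℕ) → suc (suc m) ≤ n → Stage m → Stage (suc m)
  next-stage m m+2≤n (mkStage P linked size found unique sound found-len)
    with grow ⊤ P ⊤-linked linked (λ a _ → lookup-replicate a true)
           (nonempty P (subst (0 <_) (sym size) (s≤s z≤n))) (subst₂ _<_ (sym size) (sym (∣⊤∣≡n n)) m+2≤n)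
  ... | v , v∉P , _ , P′-linked
    with trans (∣insert∣ P v v∉P) (cong suc size)
  ... | P′-size
    with through (insert P v) P′-linked v (∈-insert P v) (suc (suc m)) (≤-reflexive (sym P′-size))
  ... | new , new-unique , new-length , new-through =
    mkStage (insert P v) P′-linked P′-size
            (new ++ found) (Unique.++⁺ new-unique unique disjoint) sound′ length-eq
    where
    disjoint : ∀ {s} → ¬ ((s ∈ new) × (s ∈ found))
    disjoint (p , q) with trans (sym (proj₂ (sound q) v (proj₁ (proj₂ (proj₂ (new-through p)))))) v∉P
    ... | ()
    sound′ : ∀ {s} → s ∈ new ++ found → IsConnSub G s × proj₁ s ⊆ˢ insert P v
    sound′ s∈ with ∈-++⁻ new s∈
    ... | inj₁ s∈new   = proj₁ (new-through s∈new) , proj₁ (proj₂ (new-through s∈new))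
    ... | inj₂ s∈found = proj₁ (sound s∈found) , λ a a∈ → ⊆-insert P v a (proj₂ (sound s∈found) a a∈)
    length-eq : length (new ++ found) ≡ suc (suc (suc m)) C 2
    length-eq = begin
      length (new ++ found)                 ≡⟨ length-++ new ⟩
      length new + length found             ≡⟨ cong₂ _+_ (trans new-length (sym (nC1≡n (suc (suc m))))) found-len ⟩
      (suc (suc m) C 1) + (suc (suc m) C 2) ≡⟨ nCk+nC[k+1]≡[n+1]C[k+1] (suc (suc m)) 1 ⟩
      suc (suc (suc m)) C 2                 ∎
      where open ≡-Reasoning

  stage : (m : ℕ) → suc m ≤ n → Stage m
  stage zero 1≤n =
    mkStage ⁅ v₀ ⁆ (⁅⁆-linked v₀) (∣⁅x⁆∣≡1 v₀) (induced ⁅ v₀ ⁆ ∷ []) ([] ∷ [])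
      (λ { (here refl) → induced-connSub ⁅ v₀ ⁆ (⁅⁆-linked v₀) (v₀ , ∈-⁅⁆ v₀) , (λ a a∈ → a∈) }) refl
    where
    v₀ : Fin n
    v₀ = fromℕ< 1≤n
  stage (suc m) m+2≤n = next-stage m m+2≤n (stage m (≤-trans (n≤1+n _) m+2≤n))

  count-≥ : (m : ℕ) → suc m ≡ n → {k : ℕ} → HasCount (IsConnSub G) k → suc n C 2 ≤ k
  count-≥ m refl count =
    subst (_≤ _) found-len (count-≥-unique count found unique (proj₁ ∘ sound))
    where open Stage (stage m ≤-refl)

adj-Path⁻ : {N : ℕ} {x y : Fin N} → Adj (Path N) x y → toℕ y ≡ suc (toℕ x) ⊎ toℕ x ≡ suc (toℕ y)
adj-Path⁻ {x = x} {y} xy with suc (toℕ x) ≡ᵇ toℕ y in e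
... | true  = inj₁ (sym (≡ᵇ⇒≡ (suc (toℕ x)) (toℕ y) (Equivalence.from T-≡ e)))
... | false = inj₂ (sym (≡ᵇ⇒≡ (suc (toℕ y)) (toℕ x) (Equivalence.from T-≡ xy)))

adj-Path⁺ : {N : ℕ} {x y : Fin N} → toℕ y ≡ suc (toℕ x) → Adj (Path N) x y
adj-Path⁺ {x = x} {y} y≡x+1 with suc (toℕ x) ≡ᵇ toℕ y in e
... | true  = refl
... | false = ⊥-elim (subst T e (≡⇒≡ᵇ (suc (toℕ x)) (toℕ y) (sym y≡x+1)))

path-down : {N : ℕ} (k : ℕ) (i j : Fin N) → toℕ i ≡ k + toℕ j → Walk (Adj (Path N)) i j
path-down zero    i      j i≡j = walk-subst refl (toℕ-injective i≡j) here
path-down (suc k) (fs i) j i≡  =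
  step (trans (Graph.adj-sym (Path _) (fs i) (inject₁ i)) (adj-Path⁺ (cong suc (sym (toℕ-inject₁ i)))))
       (path-down k (inject₁ i) j (trans (toℕ-inject₁ i) (suc-injective i≡)))

path-connected : (N : ℕ) → Connected (Path N)
path-connected N i j with ≤-total (toℕ j) (toℕ i)
... | inj₁ j≤i = path-down (toℕ i ∸ toℕ j) i j (sym (m∸n+n≡m j≤i))
... | inj₂ i≤j = walk-reverse (λ {a} {b} ab → trans (Graph.adj-sym (Path N) b a) ab)
                              (path-down (toℕ j ∸ toℕ i) j i (sym (m∸n+n≡m i≤j)))

-- The pairs a ≤ b < m, i.e. the endpoints of the intervals in [0,m).
endpoints : ℕ → List (ℕ × ℕ)
endpoints zero    = []
endpoints (suc m) = map (_, m) (upTo (suc m)) ++ endpoints m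

endpoints-length : (m : ℕ) → length (endpoints m) ≡ suc m C 2
endpoints-length zero    = refl
endpoints-length (suc m) = begin
  length (map (_, m) (upTo (suc m)) ++ endpoints m)     ≡⟨ length-++ (map (_, m) (upTo (suc m))) ⟩
  length (map (_, m) (upTo (suc m))) + length (endpoints m)
                                                       ≡⟨ cong₂ _+_ (trans (length-map _ (upTo (suc m))) (length-upTo (suc m))) (endpoints-length m) ⟩
  suc m + (suc m C 2)                                  ≡⟨ cong (_+ (suc m C 2)) (sym (nC1≡n (suc m))) ⟩
  (suc m C 1) + (suc m C 2)                            ≡⟨ nCk+nC[k+1]≡[n+1]C[k+1] (suc m) 1 ⟩
  suc (suc m) C 2                                      ∎
  where open ≡-Reasoning

∈-endpoints : (m a b : ℕ) → a ≤ b → b < m → (a , b) ∈ endpoints m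
∈-endpoints (suc m) a b a≤b b<m with b ≟ m
... | yes refl = ∈-++⁺ˡ (∈-map⁺ (_, m) (∈-upTo⁺ (s≤s a≤b)))
... | no  b≢m  = ∈-++⁺ʳ (map (_, m) (upTo (suc m))) (∈-endpoints m a b a≤b (≤∧≢⇒< (≤-pred b<m) b≢m))

Least Greatest : {N : ℕ} → Subset N → Set
Least    {N} V = Σ (Fin N) λ a → a ∈ˢ V × ((c : Fin N) → c ∈ˢ V → toℕ a ≤ toℕ c)
Greatest {N} V = Σ (Fin N) λ b → b ∈ˢ V × ((c : Fin N) → c ∈ˢ V → toℕ c ≤ toℕ b)

least : {N : ℕ} (V : Subset N) → Σ (Fin N) (_∈ˢ V) → Least V
least (true  ∷ V) _           = fz , refl , λ _ _ → z≤n
least (false ∷ V) (fs c , c∈) with least V (c , c∈)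
... | a , a∈ , a≤ = fs a , a∈ , λ { (fs c) c∈ → s≤s (a≤ c c∈) }

greatest : {N : ℕ} (V : Subset N) → Σ (Fin N) (_∈ˢ V) → Greatest V
greatest (x ∷ V) (c₀ , c₀∈) with any? (λ c → lookup V c ≟B true)
... | yes tail-nonempty with greatest V tail-nonempty
...   | b , b∈ , ≤b = fs b , b∈ , λ { fz _ → z≤n ; (fs c) c∈ → s≤s (≤b c c∈) }
greatest (x ∷ V) (fz , c₀∈) | no tail-empty = fz , c₀∈ , λ { fz _ → z≤n ; (fs c) c∈ → ⊥-elim (tail-empty (c , c∈)) }
greatest (x ∷ V) (fs c₀ , c₀∈) | no tail-empty = ⊥-elim (tail-empty (c₀ , c₀∈))

module PathGraph (n : ℕ) where
  open Induced (Path n)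

  interval : ℕ → ℕ → Subset n
  interval a b = tabulate (λ c → (a ≤ᵇ toℕ c) ∧ (toℕ c ≤ᵇ b))

  intervalSubgraphs : List (SubData n)
  intervalSubgraphs = map (λ (a , b) → induced (interval a b)) (endpoints n)

  intervalSubgraphs-length : length intervalSubgraphs ≡ suc n C 2
  intervalSubgraphs-length = trans (length-map _ (endpoints n)) (endpoints-length n)

  module _ (V : Subset n) (E : Mat n) (conn : IsConnSub (Path n) (V , E)) where
    private
      edges : (i j : Fin n) → InE (V , E) i j → EdgeIn V i j
      edges = proj₁ conn
      symm : (i j : Fin n) → InE (V , E) i j → InE (V , E) j i
      symm = proj₁ (proj₂ conn)
      linked : (i j : Fin n) → i ∈ˢ V → j ∈ˢ V → Walk (InE (V , E)) i j
      linked = proj₂ (proj₂ (proj₂ conn))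

    step-≤ : {x x′ : Fin n} → InE (V , E) x x′ → toℕ x′ ≤ suc (toℕ x)
    step-≤ e with adj-Path⁻ (proj₁ (edges _ _ e))
    ... | inj₁ x′≡ = ≤-reflexive x′≡
    ... | inj₂ x≡  = ≤-trans (n≤1+n _) (≤-trans (≤-reflexive (sym x≡)) (n≤1+n _))

    intermediate : {x y : Fin n} → Walk (InE (V , E)) x y → x ∈ˢ V → (k : ℕ) → toℕ x ≤ k → k ≤ toℕ y →
      Σ (Fin n) λ z → z ∈ˢ V × toℕ z ≡ k
    intermediate {x} here x∈V k x≤k k≤y = x , x∈V , ≤-antisym x≤k k≤y
    intermediate {x} (step {_} {x′} e w) x∈V k x≤k k≤y with toℕ x ≟ k
    ... | yes x≡k = x , x∈V , x≡k
    ... | no  x≢k = intermediate w (proj₂ (proj₂ (edges _ _ e))) k (≤-trans (step-≤ e) (≤∧≢⇒< x≤k x≢k)) k≤y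

    crossing : {x y : Fin n} → Walk (InE (V , E)) x y → (k : ℕ) → toℕ x ≤ k → k < toℕ y →
      Σ (Fin n) λ z → Σ (Fin n) λ z′ → InE (V , E) z z′ × toℕ z ≡ k × toℕ z′ ≡ suc k
    crossing here k x≤k k<x = ⊥-elim (<-irrefl refl (≤-trans k<x x≤k))
    crossing {x} (step {_} {x′} e w) k x≤k k<y with adj-Path⁻ (proj₁ (edges _ _ e))
    ... | inj₂ x≡ = crossing w k (≤-trans (n≤1+n _) (≤-trans (≤-reflexive (sym x≡)) x≤k)) k<y
    ... | inj₁ x′≡ with toℕ x ≟ k
    ...   | yes x≡k = x , x′ , e , x≡k , trans x′≡ (cong suc x≡k)
    ...   | no  x≢k = crossing w k (subst (_≤ k) (sym x′≡) (≤∧≢⇒< x≤k x≢k)) k<y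

    consecutive-edge : {c d : Fin n} → c ∈ˢ V → d ∈ˢ V → toℕ d ≡ suc (toℕ c) → InE (V , E) c d
    consecutive-edge {c} {d} c∈ d∈ d≡ with crossing (linked c d c∈ d∈) (toℕ c) ≤-refl (≤-reflexive (sym d≡))
    ... | z , z′ , e , z≡ , z′≡ = edge-at (toℕ-injective z≡) (toℕ-injective (trans z′≡ (sym d≡))) e
      where
      edge-at : ∀ {z z′} → z ≡ c → z′ ≡ d → InE (V , E) z z′ → InE (V , E) c d
      edge-at refl refl e = e

    private
      lo : Least V
      lo = least V (proj₁ (proj₂ (proj₂ conn)))
      hi : Greatest V
      hi = greatest V (proj₁ (proj₂ (proj₂ conn)))
      a b : Fin n
      a = proj₁ lo
      b = proj₁ hi

    V-interval : V ≡ interval (toℕ a) (toℕ b)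
    V-interval = vec-ext V λ c → true-ext (into c) (from c)
      where
      into : (c : Fin n) → c ∈ˢ V → ((toℕ a ≤ᵇ toℕ c) ∧ (toℕ c ≤ᵇ toℕ b)) ≡ true
      into c c∈ = true-∧ (Equivalence.to T-≡ (≤⇒≤ᵇ (proj₂ (proj₂ lo) c c∈)))
                         (Equivalence.to T-≡ (≤⇒≤ᵇ (proj₂ (proj₂ hi) c c∈)))
      from : (c : Fin n) → ((toℕ a ≤ᵇ toℕ c) ∧ (toℕ c ≤ᵇ toℕ b)) ≡ true → c ∈ˢ V
      from c in-range
        with intermediate (linked a b (proj₁ (proj₂ lo)) (proj₁ (proj₂ hi))) (proj₁ (proj₂ lo)) (toℕ c)
               (≤ᵇ⇒≤ _ _ (Equivalence.from T-≡ (∧-conicalˡ _ _ in-range)))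
               (≤ᵇ⇒≤ _ _ (Equivalence.from T-≡ (∧-conicalʳ _ _ in-range)))
      ... | z , z∈ , z≡c = subst (_∈ˢ V) (toℕ-injective z≡c) z∈

    E-induced : E ≡ matrix (inducedEntry V)
    E-induced = matrix-ext E λ c d → true-ext (λ e → inducedEntry⁺ {V} (edges c d e)) (from c d)
      where
      from : (c d : Fin n) → inducedEntry V c d ≡ true → InE (V , E) c d
      from c d e with inducedEntry⁻ {V} e
      ... | cd , c∈ , d∈ with adj-Path⁻ cd
      ...   | inj₁ d≡ = consecutive-edge c∈ d∈ d≡
      ...   | inj₂ c≡ = symm d c (consecutive-edge d∈ c∈ c≡)

    ∈-intervalSubgraphs : (V , E) ∈ intervalSubgraphs
    ∈-intervalSubgraphs =
      subst (_∈ intervalSubgraphs) (sym (trans (cong (V ,_) E-induced) (cong induced V-interval)))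
        (∈-map⁺ (λ (a , b) → induced (interval a b))
          (∈-endpoints n (toℕ a) (toℕ b) (proj₂ (proj₂ lo) b (proj₁ (proj₂ hi))) (toℕ<n b)))

  count-≤ : {k : ℕ} → HasCount (IsConnSub (Path n)) k → k ≤ suc n C 2
  count-≤ count = subst (_ ≤_) intervalSubgraphs-length
    (count-≤-covering count intervalSubgraphs (λ {s} conn → ∈-intervalSubgraphs (proj₁ s) (proj₂ s) conn))

-- Theorem 2.1.  F(G) is the length of the filtered list of CompleteGraph, which
-- lies between the two bounds; F(Kₙ) = M by the explicit list, and for Pₙ the
-- bounds C(n+1,2) ≤ F(Pₙ) ≤ C(n+1,2) coincide.

theorem2p1 : (h : ℕ → ℕ)
    → ((i : ℕ) → HasCount (IsConnLabeled i) (h i))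
    → (n : ℕ) → 1 ≤ n
    → ((G : Graph n) → Connected G
        → Σ ℕ λ k → HasCount (IsConnSub G) k
            × ((suc n C 2) ≤ k) × (k ≤ Mbound n h))
      × HasCount (IsConnSub (Complete n)) (Mbound n h)
      × HasCount (IsConnSub (Path n)) (suc n C 2)
theorem2p1 h labelled-count (suc m) _ = bounds , count-Complete , path-count
  where
  open CompleteGraph h labelled-count (suc m)

  bounds : (G : Graph (suc m)) → Connected G →
    Σ ℕ λ k → HasCount (IsConnSub G) k × (suc (suc m) C 2 ≤ k) × (k ≤ Mbound (suc m) h)
  bounds G G-connected =
    length (connSubs G) , count G , LowerBound.count-≥ G G-connected m refl (count G) , count-≤-M G

  path-count : HasCount (IsConnSub (Path (suc m))) (suc (suc m) C 2)
  path-count = subst (HasCount (IsConnSub (Path (suc m)))) F≡ (count (Path (suc m)))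
    where
    F≡ : length (connSubs (Path (suc m))) ≡ suc (suc m) C 2
    F≡ = ≤-antisym (PathGraph.count-≤ (suc m) (count (Path (suc m))))
                   (LowerBound.count-≥ (Path (suc m)) (path-connected (suc m)) m refl (count (Path (suc m))))
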